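{- For all integers $q\geq 2$ and $N,n\geq 1$, we have $f_{q,q-1}(N)\leq n$ if and only if $F_{q,q-1}(n)\geq N$.
   Context: $[n]=\{1,\dots,n\}$. An ordered complete graph has vertex set $[N]$ with its natural order; a path is monotone if its vertices, in traversal order, are increasing; the length of a path is its number of vertices. For a $q$-edge-colored ordered complete graph $K$ (colors from $[q]$), $f_{q,r}(K)$ is the maximum length of a monotone path in $K$ whose edges use at most $r$ colors, and $f_{q,r}(N)$ is the minimum of $f_{q,r}(K)$ over all $q$-edge-colored ordered complete graphs $K$ on $N$ vertices. For $x,y\in\mathbb{R}^q$ write $x<_r y$ if there are at least $r$ coordinates $i$ with $x_i<y_i$. $F_{q,r}(n)$ is the maximum $N$ such that there exist $x_1,\dots,x_N\in[n]^q$ with $x_a<_r x_b$ for all $a<b$. -}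

module Defs where

open import Data.Nat using (ℕ; suc; _≤_; _<_)
open import Data.Fin using (Fin; inject₁) renaming (suc to fsuc; _<_ to _<ᶠ_)
open import Data.Fin.Subset using (Subset; _∈_; ∣_∣)
open import Data.Product using (Σ; ∃; _×_)

-- A q-edge-coloring of the ordered complete graph on N vertices (vertices Fin N,
-- i.e. [N] shifted to start at 0, with the natural order). The color of the
-- edge {a,b} with a < b is  K a b ; values K a b with a ≥ b are irrelevant.
Coloring : ℕ → ℕ → Set
Coloring q N = Fin N → Fin N → Fin q

Monotone : ∀ {N m} → (Fin (suc m) → Fin N) → Set
Monotone {m = m} p = (i : Fin m) → p (inject₁ i) <ᶠ p (fsuc i)

UsesAtMost : ∀ {q N m} → ℕ → Coloring q N → (Fin (suc m) → Fin N) → Set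
UsesAtMost {q} {m = m} r K p =
  Σ (Subset q) λ S → ∣ S ∣ ≤ r × ((i : Fin m) → K (p (inject₁ i)) (p (fsuc i)) ∈ S)

fK≤ : ∀ {q N} → ℕ → Coloring q N → ℕ → Set
fK≤ {N = N} r K n =
  ∀ m (p : Fin (suc m) → Fin N) → Monotone p → UsesAtMost r K p → suc m ≤ n

-- f_{q,r}(N) ≤ n  (f_{q,r}(N) is the minimum of f_{q,r}(K) over all K):
-- some q-edge-colored ordered complete graph K on N vertices has f_{q,r}(K) ≤ n.
f≤ : ℕ → ℕ → ℕ → ℕ → Set
f≤ q r N n = ∃ λ (K : Coloring q N) → fK≤ r K n

InBox : (q : ℕ) → ℕ → (Fin q → ℕ) → Set
InBox q n x = (i : Fin q) → 1 ≤ x i × x i ≤ n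

_<[_]_ : ∀ {q} → (Fin q → ℕ) → ℕ → (Fin q → ℕ) → Set
_<[_]_ {q} x r y = Σ (Subset q) λ S → r ≤ ∣ S ∣ × ((i : Fin q) → i ∈ S → x i < y i)

Realizable : ℕ → ℕ → ℕ → ℕ → Set
Realizable q r n M =
  Σ (Fin M → Fin q → ℕ) λ x →
    ((a : Fin M) → InBox q n (x a)) × ((a b : Fin M) → a <ᶠ b → x a <[ r ] x b)

-- F_{q,r}(n) ≥ N  (F_{q,r}(n) is the maximum realizable M):
-- some M ≥ N is realizable.
F≥ : ℕ → ℕ → ℕ → ℕ → Set
F≥ q r n N = ∃ λ M → N ≤ M × Realizable q r n M

{-# OPTIONS --safe #-}
-- Given a coloring K with f(K) ≤ n, let h_c(a) be the number of edges of a longest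
-- monotone path from a avoiding color c, and put x_a(c) = n − h_c(a) ∈ [n]. If a < b
-- then h_c(a) > h_c(b) for every c other than the color of ab, so x_a <_{q−1} x_b.
-- Conversely, if x_a <_{q−1} x_b then at most one coordinate k fails to increase;
-- color ab by k. A monotone path with at most q − 1 colors misses some color c, so
-- x(·)(c) increases strictly along it, and it has at most n vertices.
module Submission where

open import Defs
open import Data.Nat using (ℕ; zero; suc; _+_; _∸_; _≤_; _<_; _⊔_; z≤n; s≤s)
open import Data.Nat.Properties
open import Data.Bool using (if_then_else_)
open import Data.Fin using (Fin; inject₁; inject≤; fromℕ) renaming (zero to fzero; suc to fsuc; _<_ to _<ᶠ_)
import Data.Fin.Properties as Fin
open import Data.Fin.Subset using (Subset; _∈_; _∉_; ∣_∣; ∁; ⁅_⁆; inside; outside)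
open import Data.Fin.Subset.Properties using (∣p∣≤n; ∣p∣≡n⇒p≡⊤; ∈⊤; ∣∁p∣≡n∸∣p∣; ∣⁅x⁆∣≡1; x∉p⇒x∈∁p; x∈∁p⇒x∉p; x≢y⇒x∉⁅y⁆; x∉⁅y⁆⇒x≢y)
open import Data.Vec.Base using ([]; _∷_; here; there)
open import Data.Product using (Σ; ∃; _×_; _,_; proj₁; proj₂)
open import Data.Sum using (_⊎_; inj₁; inj₂)
open import Function using (_∘_)
open import Function.Bundles using (_⇔_; mk⇔)
open import Level using (0ℓ)
open import Relation.Nullary using (Dec; yes; no; does; ¬?; contradiction)
import Relation.Unary as U
open import Relation.Binary using (Rel; Decidable)
open import Relation.Binary.PropositionalEquality using (_≡_; _≢_; refl; sym; trans; cong; subst; subst₂; ≢-sym)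

∣∁⁅x⁆∣≡n∸1 : ∀ {n} (x : Fin n) → ∣ ∁ ⁅ x ⁆ ∣ ≡ n ∸ 1
∣∁⁅x⁆∣≡n∸1 {n} x = trans (∣∁p∣≡n∸∣p∣ ⁅ x ⁆) (cong (n ∸_) (∣⁅x⁆∣≡1 x))

x≢y⇒x∈∁⁅y⁆ : ∀ {n} {x y : Fin n} → x ≢ y → x ∈ ∁ ⁅ y ⁆
x≢y⇒x∈∁⁅y⁆ = x∉p⇒x∈∁p ∘ x≢y⇒x∉⁅y⁆

x∈∁⁅y⁆⇒x≢y : ∀ {n} {x y : Fin n} → x ∈ ∁ ⁅ y ⁆ → x ≢ y
x∈∁⁅y⁆⇒x≢y = x∉⁅y⁆⇒x≢y ∘ x∈∁p⇒x∉p

∣p∣<n⇒∃∉ : ∀ {n} (p : Subset n) → ∣ p ∣ < n → ∃ (_∉ p)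
∣p∣<n⇒∃∉ (outside ∷ p) _ = fzero , λ ()
∣p∣<n⇒∃∉ (inside ∷ p) (s≤s ∣p∣<n) with ∣p∣<n⇒∃∉ p ∣p∣<n
... | x , x∉p = fsuc x , λ { (there x∈p) → x∉p x∈p }

n≤∣p∣⇒∈p : ∀ {n} (p : Subset n) → n ≤ ∣ p ∣ → ∀ x → x ∈ p
n≤∣p∣⇒∈p p n≤∣p∣ x = subst (x ∈_) (sym (∣p∣≡n⇒p≡⊤ (≤-antisym (∣p∣≤n p) n≤∣p∣))) ∈⊤

n≤∣p∣⇒∈p-except-one : ∀ {n} (p : Subset (suc n)) → n ≤ ∣ p ∣ → ∃ λ k → ∀ x → x ≢ k → x ∈ p
n≤∣p∣⇒∈p-except-one (outside ∷ p) n≤∣p∣ = fzero , λ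
  { fzero x≢0 → contradiction refl x≢0
  ; (fsuc x) _ → there (n≤∣p∣⇒∈p p n≤∣p∣ x) }
n≤∣p∣⇒∈p-except-one {zero} (inside ∷ []) _ = fzero , λ { fzero _ → here }
n≤∣p∣⇒∈p-except-one {suc n} (inside ∷ p) (s≤s n≤∣p∣) with n≤∣p∣⇒∈p-except-one p n≤∣p∣
... | k , ∈p = fsuc k , λ
  { fzero _ → here
  ; (fsuc x) x≢k → there (∈p x (x≢k ∘ cong fsuc)) }

increasing⇒m+h₀≤hₘ : ∀ m (h : Fin (suc m) → ℕ) → (∀ i → h (inject₁ i) < h (fsuc i)) →
                     m + h fzero ≤ h (fromℕ m)
increasing⇒m+h₀≤hₘ zero h _ = ≤-refl
increasing⇒m+h₀≤hₘ (suc m) h increasing = begin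
  suc m + h fzero    ≡⟨ sym (+-suc m (h fzero)) ⟩
  m + suc (h fzero)  ≤⟨ +-monoʳ-≤ m (increasing fzero) ⟩
  m + h (fsuc fzero) ≤⟨ increasing⇒m+h₀≤hₘ m (h ∘ fsuc) (increasing ∘ fsuc) ⟩
  h (fromℕ (suc m))  ∎
  where open ≤-Reasoning

maxWhere : ∀ {k} {P : U.Pred (Fin k) 0ℓ} → U.Decidable P → (Fin k → ℕ) → ℕ
maxWhere {zero} P? f = 0
maxWhere {suc k} P? f = (if does (P? fzero) then f fzero else 0) ⊔ maxWhere (P? ∘ fsuc) (f ∘ fsuc)

≤-maxWhere : ∀ {k} {P : U.Pred (Fin k) 0ℓ} (P? : U.Decidable P) (f : Fin k → ℕ) {x} →
             P x → f x ≤ maxWhere P? f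
≤-maxWhere P? f {fzero} Px with P? fzero
... | yes _ = m≤m⊔n _ _
... | no ¬Px = contradiction Px ¬Px
≤-maxWhere P? f {fsuc x} Px = ≤-trans (≤-maxWhere (P? ∘ fsuc) (f ∘ fsuc) Px) (m≤n⊔m _ _)

maxWhere-attained : ∀ {k} {P : U.Pred (Fin k) 0ℓ} (P? : U.Decidable P) (f : Fin k → ℕ) →
                    maxWhere P? f ≡ 0 ⊎ ∃ λ x → P x × maxWhere P? f ≡ f x
maxWhere-attained {zero} P? f = inj₁ refl
maxWhere-attained {suc k} P? f
  with P? fzero | ⊔-sel (if does (P? fzero) then f fzero else 0) (maxWhere (P? ∘ fsuc) (f ∘ fsuc))
... | yes P0 | inj₁ max≡f0 = inj₂ (fzero , P0 , max≡f0)
... | no _   | inj₁ max≡0 = inj₁ max≡0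
... | _      | inj₂ max≡rest with maxWhere-attained (P? ∘ fsuc) (f ∘ fsuc)
...   | inj₁ rest≡0 = inj₁ (trans max≡rest rest≡0)
...   | inj₂ (x , Px , rest≡fx) = inj₂ (fsuc x , Px , trans max≡rest rest≡fx)

record PathFrom {N} (E : Rel (Fin N) 0ℓ) (a : Fin N) : Set where
  field
    steps    : ℕ
    vertex   : Fin (suc steps) → Fin N
    starts   : vertex fzero ≡ a
    monotone : Monotone vertex
    edge     : ∀ i → E (vertex (inject₁ i)) (vertex (fsuc i))

module _ {N} {E : Rel (Fin N) 0ℓ} where

  trivialPath : ∀ a → PathFrom E a
  trivialPath a = record
    { steps = 0 ; vertex = λ _ → a ; starts = refl ; monotone = λ () ; edge = λ () }

  extend : ∀ {a b} → a <ᶠ b → E a b → PathFrom E b → PathFrom E a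
  extend {a} a<b Eab P = record
    { steps = suc steps ; vertex = vertex′ ; starts = refl ; monotone = monotone′ ; edge = edge′ }
    where
    open PathFrom P
    vertex′ : Fin (suc (suc steps)) → Fin N
    vertex′ fzero    = a
    vertex′ (fsuc i) = vertex i
    monotone′ : Monotone vertex′
    monotone′ fzero    = subst (a <ᶠ_) (sym starts) a<b
    monotone′ (fsuc i) = monotone i
    edge′ : ∀ i → E (vertex′ (inject₁ i)) (vertex′ (fsuc i))
    edge′ fzero    = subst (E a) (sym starts) Eab
    edge′ (fsuc i) = edge i

Shift : ∀ {N} → Rel (Fin (suc N)) 0ℓ → Rel (Fin N) 0ℓ
Shift E a b = E (fsuc a) (fsuc b)

shift? : ∀ {N} {E : Rel (Fin (suc N)) 0ℓ} → Decidable E → Decidable (Shift E)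
shift? E? a b = E? (fsuc a) (fsuc b)

liftPath : ∀ {N} {E : Rel (Fin (suc N)) 0ℓ} {a} → PathFrom (Shift E) a → PathFrom E (fsuc a)
liftPath P = record
  { steps = steps ; vertex = fsuc ∘ vertex ; starts = cong fsuc starts
  ; monotone = s≤s ∘ monotone ; edge = edge }
  where open PathFrom P

-- Counts the edges, not the vertices, of a longest monotone E-path from a.
height : ∀ {N} {E : Rel (Fin N) 0ℓ} → Decidable E → Fin N → ℕ
height E? fzero    = maxWhere (E? fzero ∘ fsuc) (suc ∘ height (shift? E?))
height E? (fsuc a) = height (shift? E?) a

height-step : ∀ {N} {E : Rel (Fin N) 0ℓ} (E? : Decidable E) {a b} →
              a <ᶠ b → E a b → height E? b < height E? a
height-step E? {fzero}  {fsuc b} _ Eab = ≤-maxWhere (E? fzero ∘ fsuc) (suc ∘ height (shift? E?)) Eab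
height-step E? {fsuc a} {fsuc b} (s≤s a<b) Eab = height-step (shift? E?) a<b Eab

height-realised : ∀ {N} {E : Rel (Fin N) 0ℓ} (E? : Decidable E) a →
                  Σ (PathFrom E a) λ P → height E? a ≤ PathFrom.steps P
height-realised E? (fsuc a) with height-realised (shift? E?) a
... | P , h≤steps = liftPath P , h≤steps
height-realised E? fzero with maxWhere-attained (E? fzero ∘ fsuc) (suc ∘ height (shift? E?))
... | inj₁ h≡0 = trivialPath fzero , ≤-reflexive h≡0
... | inj₂ (b , E0b , h≡) with height-realised (shift? E?) b
...   | P , h≤steps = extend (s≤s z≤n) E0b (liftPath P) , ≤-trans (≤-reflexive h≡) (s≤s h≤steps)

coloring⇒realizable : ∀ {q N n} (K : Coloring q N) → fK≤ (q ∸ 1) K n → Realizable q (q ∸ 1) n N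
coloring⇒realizable {q} {N} {n} K K≤n = x , inBox , increasing
  where
  avoids? : (c : Fin q) → Decidable (λ a b → K a b ≢ c)
  avoids? c a b = ¬? (K a b Fin.≟ c)

  h<n : ∀ c a → height (avoids? c) a < n
  h<n c a with height-realised (avoids? c) a
  ... | P , h≤steps = <-≤-trans (s≤s h≤steps)
          (K≤n steps vertex monotone (∁ ⁅ c ⁆ , ≤-reflexive (∣∁⁅x⁆∣≡n∸1 c) , x≢y⇒x∈∁⁅y⁆ ∘ edge))
    where open PathFrom P

  x : Fin N → Fin q → ℕ
  x a c = n ∸ height (avoids? c) a

  inBox : ∀ a → InBox q n (x a)
  inBox a c = m<n⇒0<n∸m (h<n c a) , m∸n≤m n (height (avoids? c) a)

  increasing : ∀ a b → a <ᶠ b → x a <[ q ∸ 1 ] x b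
  increasing a b a<b = ∁ ⁅ K a b ⁆ , ≤-reflexive (sym (∣∁⁅x⁆∣≡n∸1 (K a b))) , λ c c∈∁ →
    ∸-monoʳ-< (height-step (avoids? c) a<b (≢-sym (x∈∁⁅y⁆⇒x≢y c∈∁))) (<⇒≤ (h<n c a))

Realizable-≤ : ∀ {q r n M N} → N ≤ M → Realizable q r n M → Realizable q r n N
Realizable-≤ {M = M} {N} N≤M (x , inBox , increasing) =
  x ∘ ι , inBox ∘ ι , λ a b a<b → increasing (ι a) (ι b) (ι-mono a<b)
  where
  ι : Fin N → Fin M
  ι a = inject≤ a N≤M

  ι-mono : ∀ {a b} → a <ᶠ b → ι a <ᶠ ι b
  ι-mono {a} {b} = subst₂ _<_ (sym (Fin.toℕ-inject≤ a N≤M)) (sym (Fin.toℕ-inject≤ b N≤M))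

realizable⇒coloring : ∀ {q N n} → Realizable (suc q) q n N → f≤ (suc q) q N n
realizable⇒coloring {q} {N} {n} (x , inBox , increasing) = K , K≤n
  where
  exceptional : ∀ {a b} → a <ᶠ b → ∃ λ k → ∀ c → c ≢ k → x a c < x b c
  exceptional a<b with increasing _ _ a<b
  ... | S , q≤∣S∣ , S-increasing with n≤∣p∣⇒∈p-except-one S q≤∣S∣
  ...   | k , ∈S = k , λ c c≢k → S-increasing c (∈S c c≢k)

  color : ∀ {a b} → Dec (a <ᶠ b) → Fin (suc q)
  color (yes a<b) = proj₁ (exceptional a<b)
  color (no _)    = fzero

  K : Coloring (suc q) N
  K a b = color (a Fin.<? b)

  K-increasing : ∀ {a b} → a <ᶠ b → ∀ c → c ≢ K a b → x a c < x b c
  K-increasing {a} {b} a<b with a Fin.<? b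
  ... | yes a<b′ = proj₂ (exceptional a<b′)
  ... | no a≮b   = contradiction a<b a≮b

  K≤n : fK≤ q K n
  K≤n m p monotone (T , ∣T∣≤q , K∈T) with ∣p∣<n⇒∃∉ T (s≤s ∣T∣≤q)
  ... | c , c∉T = begin
    suc m                   ≡⟨ +-comm 1 m ⟩
    m + 1                   ≤⟨ +-monoʳ-≤ m (proj₁ (inBox (p fzero) c)) ⟩
    m + x (p fzero) c       ≤⟨ increasing⇒m+h₀≤hₘ m (λ i → x (p i) c) (λ i → K-increasing (monotone i) c (c≢K i)) ⟩
    x (p (fromℕ m)) c       ≤⟨ proj₂ (inBox (p (fromℕ m)) c) ⟩
    n                       ∎
    where
    open ≤-Reasoning
    c≢K : ∀ i → c ≢ K (p (inject₁ i)) (p (fsuc i))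
    c≢K i c≡K = c∉T (subst (_∈ T) (sym c≡K) (K∈T i))

proposition3p1 : (q N n : ℕ) → 2 ≤ q → 1 ≤ N → 1 ≤ n →
    f≤ q (q ∸ 1) N n ⇔ F≥ q (q ∸ 1) n N
proposition3p1 (suc q) N n _ _ _ = mk⇔
  (λ (K , K≤n) → N , ≤-refl , coloring⇒realizable K K≤n)
  (λ (M , N≤M , R) → realizable⇒coloring (Realizable-≤ N≤M R))
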